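{- Let $k\ge1$. Let $p$ be a positive integer with canonical $k$-representation $p=\sum_i\binom{a_{k-i}}{k-i}$ and $q$ a positive integer with canonical $(k-1)$-representation $q=\sum_i\binom{b_{k-1-i}}{k-1-i}$, and let $p+q=\sum_i\binom{c_{k-i}}{k-i}$ be the canonical $k$-representation of $p+q$. If $c_k-1=a_k>b_{k-1}$, then $$\sum_i\binom{c_{k-i}}{k+1-i}>\sum_i\binom{a_{k-i}}{k+1-i}+\sum_i\binom{b_{k-1-i}}{k-i}.$$
   Context: $\binom{n}{l}=0$ if $l>n$ or $l<0$. The canonical $j$-representation of a positive integer $p$ is the unique expression $p=\sum_{i=0}^s\binom{a_{j-i}}{j-i}$ with $s\ge0$ and $a_j>a_{j-1}>\dots>a_{j-s}\ge j-s>0$; sums over $i$ run over the indices present in the respective representation. -}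

module Defs where

open import Data.Nat using (ℕ; zero; suc; _+_; _≤_; _<_; _>_)
open import Data.Nat.Combinatorics using (_C_)
open import Data.List using (List; []; _∷_)
open import Data.Product using (_×_)
open import Relation.Binary.PropositionalEquality using (_≡_)

-- A j-representation  sum_{i=0}^s binom(a_{j-i}, j-i)  is encoded by the
-- list of its top entries  [a_j , a_{j-1} , ... , a_{j-s}].

repSum : ℕ → List ℕ → ℕ
repSum j [] = 0
repSum j (a ∷ as) = a C j + repSum (j Data.Nat.∸ 1) as

data Canonical : ℕ → List ℕ → Set where
  last : ∀ {j a} → 0 < j → j ≤ a → Canonical j (a ∷ [])
  cons : ∀ {j a b bs} → a > b → Canonical j (b ∷ bs) → Canonical (suc j) (a ∷ b ∷ bs)

IsCanonRep : ℕ → ℕ → List ℕ → Set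
IsCanonRep j p as = Canonical j as × (repSum j as ≡ p)

module Submission where

-- Write k = j + 1 and c = a + 1.  Subtracting binom(a, j+1)
-- from the hypothesis p + q = binom(a+1, j+1) + t leaves the level-j balance
-- binom(a, j) + t = r + s, where r, s, t are the lower tails of the three
-- representations (t < r < binom(a, j) and s < binom(a, j)).  The target
-- inequality reduces in the same way to  R + S < binom(a, j+1) + T  for the
-- corresponding upper sums.
--
-- Both are read off one list Δ a j of length binom(a, j) and total
-- binom(a, j+1): for every canonical j-representation with entries below a,
-- its value and its upper sum are the length and the total of a prefix of
-- Δ a j (prefixOf).  The whole argument then rests on a single shape
-- property: Δ a j is tail-heavy, i.e. each nonempty window not reaching the
-- end weighs strictly less than the suffix of the same length.  Tail-heaviness
-- is proved by induction on a through the Pascal recursion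
-- Δ (a+1) (j+1) = Δ a (j+1) ++ Δ a j, together with two comparison relations
-- between different lists (Light / StrictlyLight, Heavy) that are stable
-- under concatenation.  Finally, tail-heaviness makes prefix weights strictly
-- "superadditive" (tailHeavy-prefixes), which is exactly the claim.

open import Defs
open import Data.Nat using (ℕ; zero; suc; _+_; _∸_; _≤_; _<_; _>_; z≤n; s≤s)
open import Data.Nat.Properties
open import Data.Nat.Combinatorics using (_C_; nCk+nC[k+1]≡[n+1]C[k+1]; nC1≡n; nCn≡1)
open import Data.Nat.ListAction using (sum)
open import Data.Nat.ListAction.Properties using (sum-++)
open import Data.List using (List; []; _∷_; _++_; length)
open import Data.List.Properties using (++-assoc; length-++; ∷-injective; ++-identityʳ; ++-conicalˡ; ++-conicalʳ)
open import Data.List.Relation.Unary.All as All using (All; []; _∷_)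
open import Data.List.Relation.Unary.All.Properties using (++⁻ˡ; ++⁻ʳ; ++⁺)
open import Data.Product using (Σ; _×_; _,_; proj₁; proj₂)
open import Data.Sum using (_⊎_; inj₁; inj₂)
open import Data.Unit using (⊤; tt)
open import Data.Empty using (⊥-elim)
open import Relation.Binary.PropositionalEquality
open import Data.Nat.Solver using (module +-*-Solver)
open +-*-Solver using (solve; _:=_; _:+_)

++-split : ∀ (A B U V : List ℕ) → A ++ B ≡ U ++ V →
  (Σ (List ℕ) λ M → U ≡ A ++ M × B ≡ M ++ V) ⊎ (Σ (List ℕ) λ M → A ≡ U ++ M × V ≡ M ++ B)
++-split [] B U V eq = inj₁ (U , refl , eq)
++-split (x ∷ A) B [] V eq = inj₂ (x ∷ A , refl , sym eq)
++-split (x ∷ A) B (y ∷ U) V eq with ∷-injective eq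
... | refl , eq′ with ++-split A B U V eq′
...   | inj₁ (M , e₁ , e₂) = inj₁ (M , cong (x ∷_) e₁ , e₂)
...   | inj₂ (M , e₁ , e₂) = inj₂ (M , cong (x ∷_) e₁ , e₂)

length≡0⇒[] : ∀ {w : List ℕ} → length w ≡ 0 → w ≡ []
length≡0⇒[] {[]} _ = refl

cutAt : ∀ n (w : List ℕ) → n ≤ length w →
  Σ (List ℕ) λ w₁ → Σ (List ℕ) λ w₂ → w ≡ w₁ ++ w₂ × length w₁ ≡ n
cutAt zero w _ = [] , w , refl , refl
cutAt (suc n) (x ∷ w) (s≤s n≤w) with cutAt n w n≤w
... | w₁ , w₂ , e , l = x ∷ w₁ , w₂ , cong (x ∷_) e , cong suc l

cutAlong : ∀ (w M Y : List ℕ) → length w ≡ length (M ++ Y) →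
  Σ (List ℕ) λ w₁ → Σ (List ℕ) λ w₂ →
    w ≡ w₁ ++ w₂ × length w₁ ≡ length M × length w₂ ≡ length Y
cutAlong w M Y l with cutAt (length M) w (≤-trans (m≤m+n (length M) (length Y)) (≤-reflexive (sym (trans l (length-++ M)))))
... | w₁ , w₂ , refl , l₁ = w₁ , w₂ , refl , l₁ ,
  +-cancelˡ-≡ (length w₁) _ _ (trans (sym (length-++ w₁)) (trans l (trans (length-++ M) (cong (_+ length Y) (sym l₁)))))

subwindowˡ : ∀ {S : List ℕ} A w₁ w₂ B → S ≡ A ++ (w₁ ++ w₂) ++ B → S ≡ A ++ w₁ ++ (w₂ ++ B)
subwindowˡ A w₁ w₂ B e = trans e (cong (A ++_) (++-assoc w₁ w₂ B))

subwindowʳ : ∀ {S : List ℕ} A w₁ w₂ B → S ≡ A ++ (w₁ ++ w₂) ++ B → S ≡ (A ++ w₁) ++ w₂ ++ B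
subwindowʳ A w₁ w₂ B e = trans (subwindowˡ A w₁ w₂ B e) (sym (++-assoc A w₁ (w₂ ++ B)))

window-[] : ∀ A (w : List ℕ) B → [] ≡ A ++ w ++ B → w ≡ []
window-[] [] [] B e = refl

suffix-unique : ∀ (A w X Y : List ℕ) → A ++ w ≡ X ++ Y → length w ≡ length Y → w ≡ Y
suffix-unique A w X Y e l with ++-split A w X Y e
... | inj₁ (M , _ , refl) = cong (_++ Y) (length≡0⇒[] (+-cancelʳ-≡ (length Y) (length M) 0 (trans (sym (length-++ M)) l)))
... | inj₂ (M , _ , refl) = sym (cong (_++ w) (length≡0⇒[] (+-cancelʳ-≡ (length w) (length M) 0 (trans (sym (length-++ M)) (sym l)))))

-- Comparisons between the windows (contiguous sublists) of one list and the
-- prefixes or suffixes of another.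

Light : List ℕ → List ℕ → Set
Light S T = ∀ A w B X Y → S ≡ A ++ w ++ B → T ≡ X ++ Y →
  length w ≡ length Y → sum w ≤ sum Y

StrictlyLight : List ℕ → List ℕ → Set
StrictlyLight S T = ∀ A w B X Y → S ≡ A ++ w ++ B → T ≡ X ++ Y →
  length w ≡ length Y → 0 < length w → sum w < sum Y

Heavy : List ℕ → List ℕ → Set
Heavy T S = ∀ A w B X Y → T ≡ A ++ w ++ B → S ≡ X ++ Y →
  length w ≡ length X → sum X ≤ sum w

TailHeavy : List ℕ → Set
TailHeavy S = ∀ A w B X Y → S ≡ A ++ w ++ B → S ≡ X ++ Y →
  length w ≡ length Y → 0 < length w → 0 < length B → sum w < sum Y

length-window : ∀ {S : List ℕ} A w B → S ≡ A ++ w ++ B → length S ≡ length A + (length w + length B)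
length-window A w B refl = trans (length-++ A) (cong (length A +_) (length-++ w))

strictlyLight⇒light : ∀ {S T} → StrictlyLight S T → Light S T
strictlyLight⇒light h A [] B X Y eS eT l = z≤n
strictlyLight⇒light h A (x ∷ w) B X Y eS eT l = <⇒≤ (h A (x ∷ w) B X Y eS eT l (s≤s z≤n))

-- A tail-heavy list is light with respect to itself: the only window that may
-- reach the end is the suffix itself.
tailHeavy⇒light : ∀ {S} → TailHeavy S → Light S S
tailHeavy⇒light h A [] B X Y eS eT l = z≤n
tailHeavy⇒light h A (x ∷ w) (b ∷ B) X Y eS eT l = <⇒≤ (h A (x ∷ w) (b ∷ B) X Y eS eT l (s≤s z≤n) (s≤s z≤n))
tailHeavy⇒light h A (x ∷ w) [] X Y eS eT l =
  ≤-reflexive (cong sum (suffix-unique A (x ∷ w) X Y (trans (sym (trans eS (cong (A ++_) (++-identityʳ (x ∷ w))))) eT) l))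

strictlyLight-[] : ∀ {T} → StrictlyLight [] T
strictlyLight-[] A w B X Y eS eT l p with window-[] A w B eS
strictlyLight-[] A .[] B X Y eS eT l () | refl

heavy-[] : ∀ {T} → Heavy T []
heavy-[] A w B [] Y eT eS l = z≤n

tailHeavy-[] : TailHeavy []
tailHeavy-[] A w B X Y eS eT l pw pB with window-[] A w B eS
tailHeavy-[] A .[] B X Y eS eT l () pB | refl

tailHeavy-[x] : ∀ x → TailHeavy (x ∷ [])
tailHeavy-[x] x A w B X Y eS eT l pw pB
  with ≤-trans (+-mono-≤ pw pB) (≤-trans (m≤n+m _ (length A)) (≤-reflexive (sym (length-window A w B eS))))
... | s≤s ()

window-All : ∀ {P : ℕ → Set} {S} A w B → All P S → S ≡ A ++ w ++ B → All P w
window-All A w B h refl = ++⁻ˡ w (++⁻ʳ A h)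

strictlyLight-[x] : ∀ {x S} → All (_< x) S → StrictlyLight S (x ∷ [])
strictlyLight-[x] h A (e ∷ []) B [] Y eS refl l p with window-All A (e ∷ []) B h eS
... | e<x ∷ _ = +-monoˡ-< 0 e<x
strictlyLight-[x] h A (e ∷ f ∷ w) B [] Y eS refl () p
strictlyLight-[x] h A (e ∷ w) B (e′ ∷ X) Y eS eT l p with ++-conicalʳ X Y (sym (proj₂ (∷-injective eT)))
strictlyLight-[x] h A (e ∷ w) B (e′ ∷ X) .[] eS eT () p | refl

heavy-[x] : ∀ {x S} → All (_≤ x) S → Heavy (x ∷ []) S
heavy-[x] h A w B [] Y eT eS l = z≤n
heavy-[x] h [] (y ∷ []) B (e ∷ []) Y refl refl l with h
... | e≤x ∷ _ = +-monoˡ-≤ 0 e≤x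
heavy-[x] h [] (y ∷ z ∷ w) B (e ∷ X) Y () eS l
heavy-[x] h (a ∷ A) w B (e ∷ X) Y eT eS l with window-[] A w B (proj₂ (∷-injective eT))
heavy-[x] h (a ∷ A) .[] B (e ∷ X) Y eT eS () | refl

-- Concatenation rules.  The target T = X′ ++ Y′ of a strict comparison: a
-- window long enough to meet X′ is cut into a part compared with a suffix of
-- X′ and a part compared with all of Y′.
strictlyLight-++ʳ : ∀ {S X′ Y′} → Light S X′ → StrictlyLight S Y′ →
  (Y′ ≡ [] → StrictlyLight S X′) → StrictlyLight S (X′ ++ Y′)
strictlyLight-++ʳ {S} {X′} {Y′} hX hY hE A w B X Y eS eT l p with ++-split X′ Y′ X Y eT
... | inj₁ (M , e₁ , e₂) = hY A w B M Y eS e₂ l p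
... | inj₂ (M , refl , refl) with cutAlong w M Y′ l
...   | w₁ , (x ∷ w₂) , refl , l₁ , l₂ =
        subst₂ _<_ (sym (sum-++ w₁ (x ∷ w₂))) (sym (sum-++ M Y′))
          (+-mono-≤-< (hX A w₁ ((x ∷ w₂) ++ B) X M (subwindowˡ A w₁ (x ∷ w₂) B eS) refl l₁)
                      (hY (A ++ w₁) (x ∷ w₂) B [] Y′ (subwindowʳ A w₁ (x ∷ w₂) B eS) refl l₂ (s≤s z≤n)))
...   | w₁ , [] , refl , l₁ , l₂ with length≡0⇒[] {Y′} (sym l₂)
...     | refl =
        subst₂ _<_ (sym (sum-++ w₁ [])) (sym (sum-++ M []))
          (+-monoˡ-< 0 (hE refl A w₁ B X M (trans eS (cong (λ v → A ++ v ++ B) (++-identityʳ w₁))) refl l₁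
            (subst (0 <_) (trans (length-++ w₁) (+-identityʳ _)) p)))

-- The source S = U ++ V of a strict comparison: a window meeting both U and V
-- is a suffix of U followed by a prefix of V.
strictlyLight-++ˡ : ∀ {U V T} → StrictlyLight U T → StrictlyLight V T → Heavy T V →
  StrictlyLight (U ++ V) T
strictlyLight-++ˡ {U} {V} {T} hU hV hG A w B X Y eS eT l p with ++-split U V A (w ++ B) eS
... | inj₁ (M , e₁ , e₂) = hV M w B X Y e₂ eT l p
... | inj₂ (M , e₁ , e₂) with ++-split w B M V e₂
...   | inj₁ (M₂ , refl , e₄) = hU A w M₂ X Y e₁ eT l p
...   | inj₂ (M₂ , refl , e₄) with M
...     | [] = hV [] M₂ B X Y e₄ eT l p
...     | z ∷ M′ with cutAlong Y M₂ (z ∷ M′)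
                      (trans (sym l) (trans (length-++ (z ∷ M′)) (trans (+-comm (length (z ∷ M′)) (length M₂)) (sym (length-++ M₂)))))
...       | Y₁ , Y₂ , refl , l₁ , l₂ =
          subst₂ _<_ (sym (sum-++ (z ∷ M′) M₂)) (trans (+-comm (sum Y₂) (sum Y₁)) (sym (sum-++ Y₁ Y₂)))
            (+-mono-<-≤ (hU A (z ∷ M′) [] (X ++ Y₁) Y₂ (trans e₁ (cong (A ++_) (sym (++-identityʳ (z ∷ M′)))))
                           (trans eT (sym (++-assoc X Y₁ Y₂))) (sym l₂) (s≤s z≤n))
                        (hG X Y₁ Y₂ M₂ B eT e₄ l₁))

heavy-++ʳ : ∀ {T X′ Y′} → Heavy T X′ → Heavy T Y′ → Heavy T (X′ ++ Y′)
heavy-++ʳ {T} {X′} {Y′} hX hY A w B X Y eT eS l with ++-split X′ Y′ X Y eS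
... | inj₂ (M , e₁ , e₂) = hX A w B X M eT e₁ l
... | inj₁ (M , refl , e₂) with cutAlong w X′ M l
...   | w₁ , w₂ , refl , l₁ , l₂ =
        subst₂ _≤_ (sym (sum-++ X′ M)) (sym (sum-++ w₁ w₂))
          (+-mono-≤ (hX A w₁ (w₂ ++ B) X′ [] (subwindowˡ A w₁ w₂ B eT) (sym (++-identityʳ X′)) l₁)
                    (hY (A ++ w₁) w₂ B M Y (subwindowʳ A w₁ w₂ B eT) e₂ l₂))

-- The windowed list T = U ++ V of a Heavy comparison; a window meeting both
-- halves uses that the prefix of S is no heavier than the suffix of U.
heavy-++ˡ : ∀ {U V S} → Heavy U S → Heavy V S → Light S U → Heavy (U ++ V) S
heavy-++ˡ {U} {V} {S} hU hV hL A w B X Y eT eS l with ++-split U V A (w ++ B) eT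
... | inj₁ (M , e₁ , e₂) = hV M w B X Y e₂ eS l
... | inj₂ (M , e₁ , e₂) with ++-split w B M V e₂
...   | inj₁ (M₂ , refl , e₄) = hU A w M₂ X Y e₁ eS l
...   | inj₂ (M₂ , refl , e₄) with cutAlong X M₂ M
                                  (trans (sym l) (trans (length-++ M) (trans (+-comm (length M) (length M₂)) (sym (length-++ M₂)))))
...     | X₁ , X₂ , refl , l₁ , l₂ =
          subst₂ _≤_ (trans (+-comm (sum X₂) (sum X₁)) (sym (sum-++ X₁ X₂))) (sym (sum-++ M M₂))
            (+-mono-≤ (hL X₁ X₂ Y A M (trans eS (++-assoc X₁ X₂ Y)) e₁ l₂)
                      (hV [] M₂ B X₁ (X₂ ++ Y) e₄ (trans eS (++-assoc X₁ X₂ Y)) (sym l₁)))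

short-suffix : ∀ (U V X Y : List ℕ) → U ++ V ≡ X ++ Y → length Y ≤ length V →
  Σ (List ℕ) λ M → V ≡ M ++ Y
short-suffix U V X Y e Y≤V with ++-split U V X Y e
... | inj₁ (M , _ , eV) = M , eV
... | inj₂ (M , _ , refl) with length≡0⇒[] {M} (n≤0⇒n≡0 (+-cancelʳ-≤ (length V) (length M) 0
                              (≤-trans (≤-reflexive (sym (length-++ M))) Y≤V)))
...   | refl = [] , refl

long-prefix : ∀ (U V X Y : List ℕ) → U ++ V ≡ X ++ Y → length U ≤ length X →
  Σ (List ℕ) λ M → V ≡ M ++ Y
long-prefix U V X Y e U≤X with ++-split U V X Y e
... | inj₁ (M , _ , eV) = M , eV
... | inj₂ (M , refl , refl) with length≡0⇒[] {M} (n≤0⇒n≡0 (+-cancelˡ-≤ (length X) (length M) 0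
                                 (≤-trans (≤-reflexive (sym (length-++ X))) (≤-trans U≤X (≤-reflexive (sym (+-identityʳ _)))))))
...   | refl = [] , refl

-- A prefix longer than U is
-- U ++ M; the matching window splits into a part compared with U and a part,
-- lying inside V, compared with the prefix M of V.
heavy-self-++ : ∀ {U V} → Heavy U U → Heavy V U → Light U U → Heavy V V → Heavy (U ++ V) (U ++ V)
heavy-self-++ {U} {V} hUU hVU hL hVV A w B X Y eT eS l with ++-split U V X Y eS
... | inj₂ (M , e₁ , e₂) = heavy-++ˡ hUU hVU hL A w B X M eT e₁ l
... | inj₁ (M , refl , e₂) with cutAlong w U M l
...   | w₁ , w₂ , refl , l₁ , l₂ =
        subst₂ _≤_ (sym (sum-++ U M)) (sym (sum-++ w₁ w₂))
          (+-mono-≤ (heavy-++ˡ hUU hVU hL A w₁ (w₂ ++ B) U [] (subwindowˡ A w₁ w₂ B eT) (sym (++-identityʳ U)) l₁)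
                    secondPart)
  where
  secondPart : sum M ≤ sum w₂
  secondPart with long-prefix U V (A ++ w₁) (w₂ ++ B) (subwindowʳ A w₁ w₂ B eT)
                   (≤-trans (m≤n+m (length U) (length A)) (≤-reflexive (sym (trans (length-++ A) (cong (length A +_) l₁)))))
  ... | K , eV = hVV K w₂ B M Y eV e₂ l₂

-- A window inside V, compared with a suffix of U ++ V: the suffix is shorter
-- than V, hence a suffix of V.
tailHeavy-inside-right : ∀ {U V} → TailHeavy V → ∀ K w B X Y → V ≡ K ++ w ++ B → U ++ V ≡ X ++ Y →
  length w ≡ length Y → 0 < length w → 0 < length B → sum w < sum Y
tailHeavy-inside-right {U} {V} h K w B X Y eV eT l pw pB
  with short-suffix U V X Y eT (≤-trans (≤-reflexive (sym l))
         (≤-trans (m≤m+n (length w) (length B)) (≤-trans (m≤n+m _ (length K)) (≤-reflexive (sym (length-window K w B eV))))))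
... | M , eV′ = h K w B M Y eV eV′ l pw pB

-- A window M ++ M₂ straddling U ++ V, compared with a suffix Y of V: M is
-- compared strictly with the last |M| entries of Y, M₂ with the window of V
-- before them.
straddle-inside-right : ∀ {U V} → StrictlyLight U V → Heavy V V → TailHeavy V →
  ∀ A M M₂ B X Y → U ≡ A ++ M → V ≡ M₂ ++ B → V ≡ X ++ Y →
  length (M ++ M₂) ≡ length Y → 0 < length (M ++ M₂) → 0 < length B → sum (M ++ M₂) < sum Y
straddle-inside-right hUV hVV hV A [] M₂ B X Y eU eV eV′ l pw pB = hV [] M₂ B X Y eV eV′ l pw pB
straddle-inside-right hUV hVV hV A (z ∷ M) M₂ B X Y eU eV eV′ l pw pB
  with cutAlong Y M₂ (z ∷ M) (trans (sym l) (trans (length-++ (z ∷ M)) (trans (+-comm (length (z ∷ M)) (length M₂)) (sym (length-++ M₂)))))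
... | Y₁ , Y₂ , refl , l₁ , l₂ =
  subst₂ _<_ (sym (sum-++ (z ∷ M) M₂)) (trans (+-comm (sum Y₂) (sum Y₁)) (sym (sum-++ Y₁ Y₂)))
    (+-mono-<-≤ (hUV A (z ∷ M) [] (X ++ Y₁) Y₂ (trans eU (cong (A ++_) (sym (++-identityʳ (z ∷ M)))))
                   (trans eV′ (sym (++-assoc X Y₁ Y₂))) (sym l₂) (s≤s z≤n))
                (hVV X Y₁ Y₂ M₂ B eV′ eV l₁))

-- A window M ++ M₂ straddling U ++ V, compared with a suffix M″ ++ V reaching
-- into U: the first |B| entries of M are compared strictly with the rest B
-- of V, the remaining entries of M with M″, and M₂ cancels.
straddle-into-left : ∀ {U V} → Light U U → StrictlyLight U V →
  ∀ A M M₂ B X M″ → U ≡ A ++ M → V ≡ M₂ ++ B → U ≡ X ++ M″ →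
  length (M ++ M₂) ≡ length (M″ ++ V) → 0 < length B → sum (M ++ M₂) < sum (M″ ++ V)
straddle-into-left {U} {V} hUU hUV A M M₂ B X M″ eU eV eU′ l pB
  with cutAlong M B M″ (trans lengthM (sym (length-++ B)))
  where
  lengthM : length M ≡ length B + length M″
  lengthM = +-cancelʳ-≡ (length M₂) (length M) (length B + length M″) (begin
    length M + length M₂              ≡⟨ sym (length-++ M) ⟩
    length (M ++ M₂)                  ≡⟨ l ⟩
    length (M″ ++ V)                  ≡⟨ length-++ M″ ⟩
    length M″ + length V              ≡⟨ cong (λ v → length M″ + length v) eV ⟩
    length M″ + length (M₂ ++ B)      ≡⟨ cong (length M″ +_) (length-++ M₂) ⟩
    length M″ + (length M₂ + length B) ≡⟨ solve 3 (λ m″ m₂ b → m″ :+ (m₂ :+ b) := (b :+ m″) :+ m₂) refl (length M″) (length M₂) (length B) ⟩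
    (length B + length M″) + length M₂ ∎)
    where open ≡-Reasoning
... | M₃ , M₄ , refl , l₃ , l₄ = begin-strict
  sum ((M₃ ++ M₄) ++ M₂)        ≡⟨ trans (sum-++ (M₃ ++ M₄) M₂) (cong (_+ sum M₂) (sum-++ M₃ M₄)) ⟩
  (sum M₃ + sum M₄) + sum M₂    <⟨ +-monoˡ-< (sum M₂) (+-mono-<-≤ firstPart secondPart) ⟩
  (sum B + sum M″) + sum M₂     ≡⟨ solve 3 (λ b m″ m₂ → (b :+ m″) :+ m₂ := m″ :+ (m₂ :+ b)) refl (sum B) (sum M″) (sum M₂) ⟩
  sum M″ + (sum M₂ + sum B)     ≡⟨ sym (trans (sum-++ M″ V) (cong (sum M″ +_) (trans (cong sum eV) (sum-++ M₂ B)))) ⟩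
  sum (M″ ++ V)                 ∎
  where
  open ≤-Reasoning
  firstPart : sum M₃ < sum B
  firstPart = hUV A M₃ M₄ M₂ B eU eV l₃ (subst (0 <_) (sym l₃) pB)
  secondPart : sum M₄ ≤ sum M″
  secondPart = hUU (A ++ M₃) M₄ [] X M″
    (trans eU (trans (sym (++-assoc A M₃ M₄)) (cong ((A ++ M₃) ++_) (sym (++-identityʳ M₄))))) eU′ l₄

tailHeavy-++ : ∀ {U V} → Light U U → StrictlyLight U V → (V ≡ [] → U ≡ []) → TailHeavy V → Heavy V V →
  TailHeavy (U ++ V)
tailHeavy-++ {U} {V} hUU hUV emp hV hVV A w B X Y eS eT l pw pB with ++-split U V A (w ++ B) eS
... | inj₁ (M , e₁ , e₂) = tailHeavy-inside-right {U} hV M w B X Y e₂ eT l pw pB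
... | inj₂ (M , e₁ , e₂) with ++-split w B M V e₂
...   | inj₁ (M₂ , refl , e₄) =
        strictlyLight-++ʳ hUU hUV (λ V≡[] → subst (λ Z → StrictlyLight Z U) (sym (emp V≡[])) strictlyLight-[])
          A w M₂ X Y e₁ eT l pw
...   | inj₂ (M₂ , refl , e₄) with ++-split U V X Y eT
...     | inj₁ (M″ , _ , e₆) = straddle-inside-right hUV hVV hV A M M₂ B M″ Y e₁ e₄ e₆ l pw pB
...     | inj₂ (M″ , e₅ , refl) = straddle-into-left hUU hUV A M M₂ B X M″ e₁ e₄ e₅ l pB

pascal : ∀ n k → suc n C suc k ≡ n C k + n C suc k
pascal n k = sym (nCk+nC[k+1]≡[n+1]C[k+1] n k)

C-mono : ∀ {m n} k → m ≤ n → m C k ≤ n C k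
C-mono {m} {n} k m≤n with m≤n⇒m<n∨m≡n m≤n
... | inj₂ refl = ≤-refl
... | inj₁ m<n with n
...   | suc n′ = ≤-trans (C-mono k (≤-pred m<n)) (step n′ k)
  where
  step : ∀ n k → n C k ≤ suc n C k
  step n zero = ≤-refl
  step n (suc k) = ≤-trans (m≤n+m _ (n C k)) (≤-reflexive (sym (pascal n k)))

C-pos : ∀ {x j} → j ≤ x → 0 < x C j
C-pos {x} {j} j≤x = ≤-trans (≤-reflexive (sym (nCn≡1 j))) (C-mono j j≤x)

-- The increment list Δ a j, of length binom(a, j) and total binom(a, j+1),
-- built along Pascal's rule.  Its prefix sums are the upper sums of canonical
-- representations (see prefixOf below).
Δ : ℕ → ℕ → List ℕ
Δ a zero = a ∷ []
Δ zero (suc j) = []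
Δ (suc b) (suc j) = Δ b (suc j) ++ Δ b j

length-Δ : ∀ a j → length (Δ a j) ≡ a C j
length-Δ a zero = refl
length-Δ zero (suc j) = refl
length-Δ (suc b) (suc j) = begin
  length (Δ b (suc j) ++ Δ b j)        ≡⟨ length-++ (Δ b (suc j)) ⟩
  length (Δ b (suc j)) + length (Δ b j) ≡⟨ cong₂ _+_ (length-Δ b (suc j)) (length-Δ b j) ⟩
  b C suc j + b C j                     ≡⟨ +-comm (b C suc j) (b C j) ⟩
  b C j + b C suc j                     ≡⟨ sym (pascal b j) ⟩
  suc b C suc j                         ∎
  where open ≡-Reasoning

sum-Δ : ∀ a j → sum (Δ a j) ≡ a C suc j
sum-Δ a zero = trans (+-identityʳ a) (sym (nC1≡n a))
sum-Δ zero (suc j) = refl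
sum-Δ (suc b) (suc j) = begin
  sum (Δ b (suc j) ++ Δ b j)        ≡⟨ sum-++ (Δ b (suc j)) (Δ b j) ⟩
  sum (Δ b (suc j)) + sum (Δ b j)   ≡⟨ cong₂ _+_ (sum-Δ b (suc j)) (sum-Δ b j) ⟩
  b C suc (suc j) + b C suc j       ≡⟨ +-comm (b C suc (suc j)) (b C suc j) ⟩
  b C suc j + b C suc (suc j)       ≡⟨ sym (pascal b (suc j)) ⟩
  suc b C suc (suc j)               ∎
  where open ≡-Reasoning

Δ-bounded : ∀ a j → All (_≤ a) (Δ a j)
Δ-bounded a zero = ≤-refl ∷ []
Δ-bounded zero (suc j) = []
Δ-bounded (suc b) (suc j) = ++⁺ (All.map m≤n⇒m≤1+n (Δ-bounded b (suc j))) (All.map m≤n⇒m≤1+n (Δ-bounded b j))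

Δ-bounded-< : ∀ b j → All (_< suc b) (Δ (suc b) (suc j))
Δ-bounded-< b j = ++⁺ (All.map s≤s (Δ-bounded b (suc j))) (All.map s≤s (Δ-bounded b j))

Δ-empty-suc : ∀ b j → Δ b j ≡ [] → Δ b (suc j) ≡ []
Δ-empty-suc zero (suc j) e = refl
Δ-empty-suc (suc b) (suc j) e =
  cong₂ _++_ (Δ-empty-suc b (suc j) (++-conicalˡ (Δ b (suc j)) (Δ b j) e))
             (Δ-empty-suc b j (++-conicalʳ (Δ b (suc j)) (Δ b j) e))

Δ-empty-mono : ∀ b j m → j ≤ m → Δ b j ≡ [] → Δ b m ≡ []
Δ-empty-mono b j m j≤m e with m≤n⇒m<n∨m≡n j≤m
... | inj₂ refl = e
... | inj₁ j<m with m
...   | suc m′ = Δ-empty-suc b m′ (Δ-empty-mono b j m′ (≤-pred j<m) e)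

record Shape (a : ℕ) : Set where
  field
    tailHeavy     : ∀ j → TailHeavy (Δ a j)
    strictlyLight : ∀ j j′ → j′ < j → StrictlyLight (Δ a j) (Δ a j′)
    heavy         : ∀ j j′ → j′ ≤ j → Heavy (Δ a j′) (Δ a j)

  light : ∀ j j′ → j′ ≤ j → Light (Δ a j) (Δ a j′)
  light j j′ j′≤j with m≤n⇒m<n∨m≡n j′≤j
  ... | inj₁ j′<j = strictlyLight⇒light (strictlyLight j j′ j′<j)
  ... | inj₂ refl = tailHeavy⇒light (tailHeavy j)

shape-zero : Shape 0
Shape.tailHeavy shape-zero zero = tailHeavy-[x] 0
Shape.tailHeavy shape-zero (suc j) = tailHeavy-[]
Shape.strictlyLight shape-zero (suc j) j′ _ = strictlyLight-[]
Shape.heavy shape-zero zero zero _ = heavy-[x] (z≤n ∷ [])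
Shape.heavy shape-zero (suc j) j′ _ = heavy-[]

shape-suc : ∀ {b} → Shape b → Shape (suc b)
Shape.tailHeavy (shape-suc {b} F) zero = tailHeavy-[x] (suc b)
Shape.tailHeavy (shape-suc {b} F) (suc j) =
  tailHeavy-++ (light (suc j) (suc j) ≤-refl) (strictlyLight (suc j) j (n<1+n j)) (Δ-empty-suc b j)
               (tailHeavy j) (heavy j j ≤-refl)
  where open Shape F
Shape.strictlyLight (shape-suc {b} F) (suc j) zero _ = strictlyLight-[x] (Δ-bounded-< b j)
Shape.strictlyLight (shape-suc {b} F) (suc j) (suc j′) (s≤s j′<j) =
  strictlyLight-++ˡ
    (strictlyLight-++ʳ (light (suc j) (suc j′) (m≤n⇒m≤1+n j′<j)) (strictlyLight (suc j) j′ (m≤n⇒m≤1+n j′<j))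
                       (λ _ → strictlyLight (suc j) (suc j′) (s≤s j′<j)))
    (strictlyLight-++ʳ (light j (suc j′) j′<j) (strictlyLight j j′ j′<j)
                       (λ e → subst (λ Z → StrictlyLight Z (Δ b (suc j′))) (sym (Δ-empty-mono b j′ j (≤-trans (n≤1+n j′) j′<j) e))
                                    strictlyLight-[]))
    (heavy-++ˡ (heavy j (suc j′) j′<j) (heavy j j′ (≤-trans (n≤1+n j′) j′<j)) (light j (suc j′) j′<j))
  where open Shape F
Shape.heavy (shape-suc {b} F) j zero _ = heavy-[x] (Δ-bounded (suc b) j)
Shape.heavy (shape-suc {b} F) (suc j) (suc j′) (s≤s j′≤j) with m≤n⇒m<n∨m≡n j′≤j
... | inj₂ refl = heavy-self-++ (heavy (suc j) (suc j) ≤-refl) (heavy (suc j) j (n≤1+n j))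
                                (light (suc j) (suc j) ≤-refl) (heavy j j ≤-refl)
  where open Shape F
... | inj₁ j′<j = heavy-++ʳ
  (heavy-++ˡ (heavy (suc j) (suc j′) (s≤s j′≤j)) (heavy (suc j) j′ (≤-trans j′≤j (n≤1+n j))) (light (suc j) (suc j′) (s≤s j′≤j)))
  (heavy-++ˡ (heavy j (suc j′) j′<j) (heavy j j′ j′≤j) (light j (suc j′) j′<j))
  where open Shape F

shape : ∀ a → Shape a
shape zero = shape-zero
shape (suc a) = shape-suc (shape a)

Δ-tailHeavy : ∀ a j → TailHeavy (Δ a j)
Δ-tailHeavy a = Shape.tailHeavy (shape a)

canonical-bound : ∀ {j x xs} → Canonical j (x ∷ xs) → repSum j (x ∷ xs) < suc x C j
canonical-bound {suc j} {x} (last _ j<x) = begin-strict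
  x C suc j + 0      ≡⟨ +-identityʳ (x C suc j) ⟩
  x C suc j          <⟨ m<n+m (x C suc j) (C-pos (≤-trans (n≤1+n j) j<x)) ⟩
  x C j + x C suc j  ≡⟨ sym (pascal x j) ⟩
  suc x C suc j      ∎
  where open ≤-Reasoning
canonical-bound {suc j} {x} (cons {b = y} {bs = ys} y<x c) = begin-strict
  x C suc j + repSum j (y ∷ ys) <⟨ +-monoʳ-< (x C suc j) (canonical-bound c) ⟩
  x C suc j + suc y C j         ≤⟨ +-monoʳ-≤ (x C suc j) (C-mono j y<x) ⟩
  x C suc j + x C j             ≡⟨ +-comm (x C suc j) (x C j) ⟩
  x C j + x C suc j             ≡⟨ sym (pascal x j) ⟩
  suc x C suc j                 ∎
  where open ≤-Reasoning

CanonicalTail : ℕ → List ℕ → Set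
CanonicalTail j L = L ≡ [] ⊎ Canonical j L

HeadBelow : ℕ → List ℕ → Set
HeadBelow a [] = ⊤
HeadBelow a (x ∷ _) = x < a

canonical-tail : ∀ {j x xs} → Canonical (suc j) (x ∷ xs) → CanonicalTail j xs × HeadBelow x xs
canonical-tail (last _ _) = inj₁ refl , tt
canonical-tail (cons y<x c) = inj₂ c , y<x

tail-bound : ∀ {j a as} → Canonical (suc j) (a ∷ as) → repSum j as < a C j
tail-bound {j} (last _ j<a) = C-pos (≤-trans (n≤1+n j) j<a)
tail-bound {j} (cons y<a c) = ≤-trans (canonical-bound c) (C-mono j y<a)

tail-below : ∀ {j a cs} → Canonical (suc j) (suc a ∷ cs) → repSum j cs < a C j →
  CanonicalTail j cs × HeadBelow a cs
tail-below (last _ _) _ = inj₁ refl , tt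
tail-below {j} {a} (cons {b = y} {bs = ys} y≤a c) t<N with m≤n⇒m<n∨m≡n (≤-pred y≤a)
... | inj₁ y<a = inj₂ c , y<a
... | inj₂ refl = ⊥-elim (<⇒≱ t<N (m≤m+n (a C j) (repSum (j ∸ 1) ys)))

prefixOf : ∀ a j L → CanonicalTail j L → HeadBelow a L →
  Σ (List ℕ) λ X → Σ (List ℕ) λ Y →
    Δ a j ≡ X ++ Y × length X ≡ repSum j L × sum X ≡ repSum (suc j) L
prefixOf a j [] _ _ = [] , Δ a j , refl , refl , refl
prefixOf (suc b) zero (x ∷ xs) (inj₂ (last () _)) _
prefixOf (suc b) (suc j) (x ∷ xs) (inj₂ c) x<a with m≤n⇒m<n∨m≡n (≤-pred x<a)
... | inj₁ x<b with prefixOf b (suc j) (x ∷ xs) (inj₂ c) x<b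
...   | X , Y , e , l , u = X , Y ++ Δ b j , trans (cong (_++ Δ b j) e) (++-assoc X Y (Δ b j)) , l , u
prefixOf (suc b) (suc j) (x ∷ xs) (inj₂ c) x<a | inj₂ refl with prefixOf b j xs (proj₁ (canonical-tail c)) (proj₂ (canonical-tail c))
... | X , Y , e , l , u =
  Δ b (suc j) ++ X , Y ,
  trans (cong (Δ b (suc j) ++_) e) (sym (++-assoc (Δ b (suc j)) X Y)) ,
  trans (length-++ (Δ b (suc j))) (cong₂ _+_ (length-Δ b (suc j)) l) ,
  trans (sum-++ (Δ b (suc j)) X) (cong₂ _+_ (sum-Δ b (suc j)) u)

rest-positive : ∀ {m n k} → m + n ≡ k → m < k → 0 < n
rest-positive {m} {zero} refl m<k = ⊥-elim (<-irrefl (sym (+-identityʳ m)) m<k)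
rest-positive {m} {suc n} _ _ = s≤s z≤n

-- Indeed R₁ = T₁ ++ M where M is a proper window as long as the suffix S₂.
tailHeavy-prefixes : ∀ {D} → TailHeavy D → ∀ R₁ R₂ S₁ S₂ T₁ T₂ →
  D ≡ R₁ ++ R₂ → D ≡ S₁ ++ S₂ → D ≡ T₁ ++ T₂ →
  length D + length T₁ ≡ length R₁ + length S₁ →
  length T₁ < length R₁ → length R₁ < length D → length S₁ < length D →
  sum R₁ + sum S₁ < sum D + sum T₁
tailHeavy-prefixes {D} h R₁ R₂ S₁ S₂ T₁ T₂ eR eS eT balance t<r r<n s<n
  with ++-split T₁ T₂ R₁ R₂ (trans (sym eT) eR)
... | inj₂ (M , refl , _) = ⊥-elim (<⇒≱ t<r (≤-trans (m≤m+n (length R₁) (length M)) (≤-reflexive (sym (length-++ R₁)))))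
... | inj₁ (M , refl , _) = begin-strict
  sum (T₁ ++ M) + sum S₁       ≡⟨ cong (_+ sum S₁) (sum-++ T₁ M) ⟩
  (sum T₁ + sum M) + sum S₁    <⟨ +-monoˡ-< (sum S₁) (+-monoʳ-< (sum T₁) window<suffix) ⟩
  (sum T₁ + sum S₂) + sum S₁   ≡⟨ solve 3 (λ t s₂ s₁ → (t :+ s₂) :+ s₁ := (s₁ :+ s₂) :+ t) refl (sum T₁) (sum S₂) (sum S₁) ⟩
  (sum S₁ + sum S₂) + sum T₁   ≡⟨ cong (_+ sum T₁) (sym (trans (cong sum eS) (sum-++ S₁ S₂))) ⟩
  sum D + sum T₁               ∎
  where
  open ≤-Reasoning
  lengthR : length T₁ + length M ≡ length (T₁ ++ M)
  lengthR = sym (length-++ T₁)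
  lengthD : ∀ X Y → D ≡ X ++ Y → length X + length Y ≡ length D
  lengthD X Y e = sym (trans (cong length e) (length-++ X))
  lengthM≡lengthS₂ : length M ≡ length S₂
  lengthM≡lengthS₂ = +-cancelˡ-≡ (length T₁ + length S₁) _ _ (begin-equality
    (length T₁ + length S₁) + length M   ≡⟨ solve 3 (λ t s m → (t :+ s) :+ m := (t :+ m) :+ s) refl (length T₁) (length S₁) (length M) ⟩
    (length T₁ + length M) + length S₁   ≡⟨ cong (_+ length S₁) lengthR ⟩
    length (T₁ ++ M) + length S₁         ≡⟨ sym balance ⟩
    length D + length T₁                 ≡⟨ cong (_+ length T₁) (sym (lengthD S₁ S₂ eS)) ⟩
    (length S₁ + length S₂) + length T₁  ≡⟨ solve 3 (λ t s u → (s :+ u) :+ t := (t :+ s) :+ u) refl (length T₁) (length S₁) (length S₂) ⟩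
    (length T₁ + length S₁) + length S₂  ∎)
  window<suffix : sum M < sum S₂
  window<suffix = h T₁ M R₂ S₁ S₂ (trans eR (++-assoc T₁ M R₂)) eS lengthM≡lengthS₂
    (rest-positive lengthR t<r) (rest-positive (lengthD (T₁ ++ M) R₂ eR) r<n)

upper-sum-gap : ∀ {j a b as bs cs} →
  Canonical (suc j) (a ∷ as) → Canonical j (b ∷ bs) → Canonical (suc j) (suc a ∷ cs) → b < a →
  repSum (suc j) (suc a ∷ cs) ≡ repSum (suc j) (a ∷ as) + repSum j (b ∷ bs) →
  repSum (suc (suc j)) (a ∷ as) + repSum (suc j) (b ∷ bs) < repSum (suc (suc j)) (suc a ∷ cs)
upper-sum-gap {j} {a} {b} {as} {bs} {cs} canA canB canC b<a sumEq = gap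
  where
  r s t N : ℕ
  r = repSum j as
  s = repSum j (b ∷ bs)
  t = repSum j cs
  N = a C j
  balance : N + t ≡ r + s
  balance = +-cancelˡ-≡ (a C suc j) _ _ (begin
    a C suc j + (N + t)   ≡⟨ solve 3 (λ u n t → u :+ (n :+ t) := (n :+ u) :+ t) refl (a C suc j) N t ⟩
    (N + a C suc j) + t   ≡⟨ cong (_+ t) (sym (pascal a j)) ⟩
    suc a C suc j + t     ≡⟨ sumEq ⟩
    (a C suc j + r) + s   ≡⟨ +-assoc (a C suc j) r s ⟩
    a C suc j + (r + s)   ∎)
    where open ≡-Reasoning
  r<N : r < N
  r<N = tail-bound canA
  s<N : s < N
  s<N = ≤-trans (canonical-bound canB) (C-mono j b<a)
  t<r : t < r
  t<r = +-cancelˡ-< N t r (subst (_< N + r) (sym balance) (subst (r + s <_) (+-comm r N) (+-monoʳ-< r s<N)))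
  cs-tail : CanonicalTail j cs × HeadBelow a cs
  cs-tail = tail-below canC (<-trans t<r r<N)
  gap : repSum (suc (suc j)) (a ∷ as) + repSum (suc j) (b ∷ bs) < repSum (suc (suc j)) (suc a ∷ cs)
  gap with prefixOf a j as (proj₁ (canonical-tail canA)) (proj₂ (canonical-tail canA))
         | prefixOf a j (b ∷ bs) (inj₂ canB) b<a
         | prefixOf a j cs (proj₁ cs-tail) (proj₂ cs-tail)
  ... | R₁ , R₂ , eR , lR , uR | S₁ , S₂ , eS , lS , uS | T₁ , T₂ , eT , lT , uT = begin-strict
    (a C suc (suc j) + repSum (suc j) as) + repSum (suc j) (b ∷ bs)
      ≡⟨ trans (+-assoc (a C suc (suc j)) _ _) (cong₂ (λ u v → a C suc (suc j) + (u + v)) (sym uR) (sym uS)) ⟩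
    a C suc (suc j) + (sum R₁ + sum S₁)
      <⟨ +-monoʳ-< (a C suc (suc j)) (tailHeavy-prefixes (Δ-tailHeavy a j) R₁ R₂ S₁ S₂ T₁ T₂ eR eS eT lengths
                     (subst₂ _<_ (sym lT) (sym lR) t<r) (subst₂ _<_ (sym lR) (sym (length-Δ a j)) r<N)
                     (subst₂ _<_ (sym lS) (sym (length-Δ a j)) s<N)) ⟩
    a C suc (suc j) + (sum (Δ a j) + sum T₁)
      ≡⟨ cong₂ (λ u v → a C suc (suc j) + (u + v)) (sum-Δ a j) uT ⟩
    a C suc (suc j) + (a C suc j + repSum (suc j) cs)
      ≡⟨ sym (+-assoc (a C suc (suc j)) _ _) ⟩
    (a C suc (suc j) + a C suc j) + repSum (suc j) cs
      ≡⟨ cong (_+ repSum (suc j) cs) (trans (+-comm (a C suc (suc j)) (a C suc j)) (sym (pascal a (suc j)))) ⟩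
    suc a C suc (suc j) + repSum (suc j) cs ∎
    where
    open ≤-Reasoning
    lengths : length (Δ a j) + length T₁ ≡ length R₁ + length S₁
    lengths = trans (cong₂ _+_ (length-Δ a j) lT) (trans balance (sym (cong₂ _+_ lR lS)))

lemma4p7 : (k : ℕ) → 1 ≤ k → (p q a b c : ℕ) → (as bs cs : List ℕ) →
    IsCanonRep k p (a ∷ as) → IsCanonRep (k ∸ 1) q (b ∷ bs) →
    IsCanonRep k (p + q) (c ∷ cs) →
    c ∸ 1 ≡ a → a > b →
    repSum (suc k) (c ∷ cs) > repSum (suc k) (a ∷ as) + repSum k (b ∷ bs)
lemma4p7 (suc j) _ p q a b zero as bs cs _ _ (last _ () , _) _ _
lemma4p7 (suc j) _ p q a b zero as bs cs _ _ (cons () _ , _) _ _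
lemma4p7 (suc j) _ p q a b (suc c) as bs cs (canA , refl) (canB , refl) (canC , sumEq) refl b<a =
  upper-sum-gap canA canB canC b<a sumEq
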